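{- Let $n\ge 2$ and let $0\le\alpha_1<\dots<\alpha_n$ be integers. The net-building algorithm described in the context, run on input $D=\{\alpha_1,\dots,\alpha_n\}$, completes in $O(n\alpha_n^4)$ time and requires at most $O(n\alpha_n^4)$ space. Its reconstruction variant requires at most $O(n\alpha_n^3)$ space.
   Context: Set $\alpha_0=0$. For each $k=0,\dots,n$ the algorithm maintains a table $L_k$ whose cells are indexed by pairs $(p,q)$ of integers with $0\le p\le 2\alpha_k+1$ and $0\le q\le (2\alpha_k+1)\alpha_k$; each cell $L_k(p,q)$ is a set of triples $(p',q',x)$ and is initially empty, except that $L_0(0,0)=\{(0,0,0)\}$. For $B(p',q',a):=\frac{h+\sqrt{h^2+8(q'-p'(p'-1)/2)}}{2}$ with $h=2(a-p')+1$: First part: for $\ell=1,\dots,n-1$, for each integer $x$ with $1\le x\le 2\alpha_\ell+1$, for each $(p',q')$ with $0\le p'\le 2\alpha_{\ell-1}+1$, $0\le q'\le(2\alpha_{\ell-1}+1)\alpha_{\ell-1}$ and $L_{\ell-1}(p',q')\neq\emptyset$: if $x\le B(p',q',\alpha_\ell)$, insert $(p',q',x)$ into $L_\ell(p'+x,\,q'+x\alpha_\ell)$. Second part: for each $(p',q')$ with $0\le p'\le 2\alpha_{n-1}+1$, $0\le q'\le (2\alpha_{n-1}+1)\alpha_{n-1}$ and $L_{n-1}(p',q')\ne\emptyset$, let $t=B(p',q',\alpha_n)$; if $t$ is an integer with $t\ge1$, insert $(p',q',t)$ into $L_n(p'+t,\,q'+t\alpha_n)$. The algorithm returns the tables $L_0,\dots,L_n$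 (the "net"). In the reconstruction variant, every insertion into a cell is performed only if that cell is currently empty (so each cell holds at most one triple). -}

module Defs where

open import Data.Nat as ℕ using (ℕ; zero; suc; _+_; _*_; _∸_; _^_; _≤_; _<_)
open import Data.Integer as ℤ using (ℤ; +_; ∣_∣)
open import Data.Bool using (Bool; true; false; if_then_else_; _∧_; _∨_; not)
open import Data.List using (List; []; _∷_; foldl; upTo; filter; null; map)
open import Data.Nat.ListAction using (sum)
open import Data.Product using (_×_; _,_)
open import Data.Maybe using (Maybe; just; nothing)
open import Relation.Nullary.Decidable using (⌊_⌋)

-- Cost model: tables are functions ℕ → ℕ → List Triple
-- (cells outside the nominal range are simply never charged as cells).
-- Time  = number of cells allocated (table initialisation)
--         + one unit per iteration of every innermost loop body
--           (test + possible insertion, unit-cost arithmetic).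
-- Space = number of cells of all tables L_0..L_n
--         + number of triples stored in all tables.

Triple : Set
Triple = ℕ × ℕ × ℕ

Table : Set
Table = ℕ → ℕ → List Triple

emptyTable : Table
emptyTable _ _ = []

_==_ : ℕ → ℕ → Bool
m == n = ⌊ m ℕ.≟ n ⌋

upd : Table → ℕ → ℕ → List Triple → Table
upd T p q v a b = if (a == p) ∧ (b == q) then v else T a b

range : ℕ → ℕ → List ℕ
range a b = map (λ i → a + i) (upTo (suc b ∸ a))

ext : (ℕ → ℕ) → ℕ → ℕ
ext α zero    = 0
ext α (suc k) = α (suc k)

-- index bounds of table L_k: 0 ≤ p ≤ 2α_k+1, 0 ≤ q ≤ (2α_k+1)α_k
pmax : (ℕ → ℕ) → ℕ → ℕ
pmax α k = 2 * ext α k + 1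

qmax : (ℕ → ℕ) → ℕ → ℕ
qmax α k = (2 * ext α k + 1) * ext α k

cells : (ℕ → ℕ) → ℕ → ℕ
cells α k = suc (pmax α k) * suc (qmax α k)

-- B(p',q',a) = (h + sqrt(h² + 8(q' - p'(p'-1)/2)))/2, h = 2(a-p')+1,
-- handled exactly with integers.

hZ : ℕ → ℕ → ℤ
hZ p a = (+ (2 * a + 1)) ℤ.- (+ (2 * p))

-- discriminant h² + 8(q' - p'(p'-1)/2) = h² + 4(2q' - p'(p'-1))
DZ : ℕ → ℕ → ℕ → ℤ
DZ p q a = (hZ p a ℤ.* hZ p a) ℤ.+ (+ 4) ℤ.* ((+ (2 * q)) ℤ.- (+ (p * (p ∸ 1))))

_≤ᵇ_ : ℤ → ℤ → Bool
i ≤ᵇ j = ⌊ i ℤ.≤? j ⌋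

_=ᵇ_ : ℤ → ℤ → Bool
i =ᵇ j = ⌊ i ℤ.≟ j ⌋

-- x ≤ B(p',q',a)  (false when the square root is not real)
leB : ℕ → ℕ → ℕ → ℕ → Bool
leB x p q a =
  let h = hZ p a ; D = DZ p q a ; d = (+ (2 * x)) ℤ.- h in
  ((+ 0) ≤ᵇ D) ∧ ((d ≤ᵇ (+ 0)) ∨ ((d ℤ.* d) ≤ᵇ D))

-- t = B(p',q',a) is a natural number t ≥ 1  iff  2t - h ≥ 0 and (2t-h)² = D
isB : ℕ → ℕ → ℕ → ℕ → Bool
isB t p q a =
  let h = hZ p a ; D = DZ p q a ; d = (+ (2 * t)) ℤ.- h in
  ((+ 0) ≤ᵇ d) ∧ ((d ℤ.* d) =ᵇ D)

firstJust : List ℕ → Maybe ℕ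
firstJust []      = nothing
firstJust (t ∷ _) = just t

-- returns just t iff B(p',q',a) is an integer t ≥ 1
-- (any such t satisfies t ≤ |h| + |D| + 1, so the search is exhaustive)
intB : ℕ → ℕ → ℕ → Maybe ℕ
intB p q a = firstJust (filter (λ t → isB t p q a Data.Bool.≟ true)
                               (range 1 (∣ hZ p a ∣ + ∣ DZ p q a ∣ + 1)))
  where import Data.Bool

data Mode : Set where
  full recon : Mode

record Acc : Set where
  constructor acc
  field
    tbl    : Table
    time   : ℕ
    stored : ℕ

tick : Acc → Acc
tick (acc T c s) = acc T (suc c) s

insert : Mode → ℕ → ℕ → Triple → Acc → Acc
insert full  p q t (acc T c s) = acc (upd T p q (t ∷ T p q)) c (suc s)
insert recon p q t (acc T c s) with T p q
... | []    = acc (upd T p q (t ∷ [])) c (suc s)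
... | _ ∷ _ = acc T c s

-- first part, iteration ℓ = suc k : builds L_ℓ from P = L_k
stepFirst : Mode → (ℕ → ℕ) → ℕ → Table → ℕ → ℕ → Acc
stepFirst m α k P c s =
  foldl (λ A₁ x →
    foldl (λ A₂ p′ →
      foldl (λ A₃ q′ → body x p′ q′ (tick A₃))
            A₂ (range 0 (qmax α k)))
      A₁ (range 0 (pmax α k)))
    (acc emptyTable (c + cells α (suc k)) s)
    (range 1 (2 * a + 1))
  where
  a = ext α (suc k)
  body : ℕ → ℕ → ℕ → Acc → Acc
  body x p′ q′ A =
    if not (null (P p′ q′)) ∧ leB x p′ q′ a
    then insert m (p′ + x) (q′ + x * a) (p′ , q′ , x) A
    else A

-- second part : builds L_n from P = L_{n-1}
stepSecond : Mode → (ℕ → ℕ) → ℕ → Table → ℕ → ℕ → Acc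
stepSecond m α n P c s =
  foldl (λ A₂ p′ →
    foldl (λ A₃ q′ → body p′ q′ (tick A₃))
          A₂ (range 0 (qmax α (n ∸ 1))))
    (acc emptyTable (c + cells α n) s)
    (range 0 (pmax α (n ∸ 1)))
  where
  a = ext α n
  ins : ℕ → ℕ → Maybe ℕ → Acc → Acc
  ins p′ q′ nothing  A = A
  ins p′ q′ (just t) A = insert m (p′ + t) (q′ + t * a) (p′ , q′ , t) A
  body : ℕ → ℕ → Acc → Acc
  body p′ q′ A = if not (null (P p′ q′)) then ins p′ q′ (intB p′ q′ a) A else A

L₀ : Table
L₀ = upd emptyTable 0 0 ((0 , 0 , 0) ∷ [])

record Run : Set where
  constructor run
  field
    tables : List Table    -- L_0, ..., L_n
    time   : ℕ
    stored : ℕ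

private
  record St : Set where
    constructor st
    field
      done : List Table  -- reversed
      last : Table
      c s  : ℕ

-- run the net-building algorithm on α_1 < ... < α_n (α : ℕ → ℕ, values at 1..n)
net : Mode → (ℕ → ℕ) → ℕ → Run
net m α n = finish (foldl step (st [] L₀ (cells α 0) 1) (range 1 (n ∸ 1)))
  where
  open import Data.List using (reverse)
  step : St → ℕ → St
  step (st d L c s) (suc k) with stepFirst m α k L c s
  ... | acc T c′ s′ = st (L ∷ d) T c′ s′
  step σ zero = σ
  finish : St → Run
  finish (st d L c s) with stepSecond m α n L c s
  ... | acc T c′ s′ = run (reverse (T ∷ L ∷ d)) c′ s′

timeOf : Run → ℕ
timeOf = Run.time

spaceOf : (ℕ → ℕ) → ℕ → Run → ℕ
spaceOf α n r = sum (map (cells α) (range 0 n)) + Run.stored r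

StrictlyIncreasing : (ℕ → ℕ) → ℕ → Set
StrictlyIncreasing α n = ∀ i → 1 ≤ i → i < n → α i < α (suc i)

{-# OPTIONS --safe #-}
module Submission where

-- The cost of a run is accumulated layer by layer. Building L_{k+1} from L_k allocates the
-- cells of L_{k+1} and visits each of the (2α_{k+1}+1) · (cells of L_k) triples (x, p′, q′)
-- once, storing at most one triple per visit. Since every α_j ≤ α_n, with X = 4α_n every
-- table has at most X³ cells and every layer costs at most 2X⁴; there are n layers. In the
-- reconstruction variant a triple is stored only when it fills an empty cell, and all cells
-- written by layer k+1 lie in a box of at most 4X³ cells, so each layer stores O(α_n³)
-- triples.

open import Defs
open import Data.Nat
  using (ℕ; zero; suc; _+_; _*_; _∸_; _^_; _≤_; _<_; z≤n; s≤s; s≤s⁻¹; _≤′_; ≤′-reflexive; ≤′-step; _≟_)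
open import Data.Nat.Properties
open import Data.Nat.ListAction using (sum)
open import Data.Nat.Solver using (module +-*-Solver)
open import Data.Bool using (Bool; true; false; if_then_else_; _∧_)
open import Data.Maybe using (just; nothing)
open import Data.List using (List; []; _∷_; foldl; length; map; upTo)
open import Data.List.Properties using (length-map; length-upTo)
open import Data.List.Relation.Unary.All as All using (All; []; _∷_)
open import Data.List.Relation.Unary.All.Properties using (map⁺; applyUpTo⁺₁; all-upTo)
open import Data.Sum using (inj₁; inj₂)
open import Data.Product using (_×_; _,_; ∃)
open import Data.Unit using (⊤; tt)
open import Relation.Binary.PropositionalEquality
open import Relation.Nullary.Decidable using (isYes≗does; dec-true)
open +-*-Solver using (solve; _:=_; _:+_; _:*_; _:^_; con)

foldl-≤ : {S X : Set} (μ : S → ℕ) {K : ℕ} {f : S → X → S} →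
          (∀ a x → μ (f a x) ≤ μ a + K) →
          ∀ a xs → μ (foldl f a xs) ≤ μ a + length xs * K
foldl-≤ μ _ a []                  = ≤-reflexive (sym (+-identityʳ (μ a)))
foldl-≤ μ {K} {f} step a (x ∷ xs) = begin
  μ (foldl f (f a x) xs)     ≤⟨ foldl-≤ μ step (f a x) xs ⟩
  μ (f a x) + length xs * K  ≤⟨ +-monoˡ-≤ (length xs * K) (step a x) ⟩
  μ a + K + length xs * K    ≡⟨ +-assoc (μ a) K (length xs * K) ⟩
  μ a + length (x ∷ xs) * K  ∎
  where open ≤-Reasoning

foldl-preserves : {S X : Set} (I : S → Set) {G : X → Set} {f : S → X → S} →
                  (∀ {a} x → G x → I a → I (f a x)) →
                  ∀ {a xs} → All G xs → I a → I (foldl f a xs)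
foldl-preserves I step {xs = []}     []         Ia = Ia
foldl-preserves I step {xs = x ∷ xs} (Gx ∷ Gxs) Ia = foldl-preserves I step Gxs (step x Gx Ia)

if-elim : {A : Set} (P : A → Set) {b : Bool} {x y : A} → P x → P y → P (if b then x else y)
if-elim P {true}  Px Py = Px
if-elim P {false} Px Py = Py

m<n∸o⇒o+m<n : ∀ o {m n} → m < n ∸ o → o + m < n
m<n∸o⇒o+m<n zero                m<n = m<n
m<n∸o⇒o+m<n (suc o) {n = suc n} m<n = s≤s (m<n∸o⇒o+m<n o m<n)

suc-*-≤ : ∀ a b → suc (a * b) ≤ suc a * suc b
suc-*-≤ a b = s≤s (≤-trans (*-monoʳ-≤ a (n≤1+n b)) (m≤n+m (a * suc b) b))

suc-+-≤ : ∀ a b → suc (a + b) ≤ suc a + suc b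
suc-+-≤ a b = s≤s (+-monoʳ-≤ a (n≤1+n b))

layer-step-≤ : ∀ a₀ K L B {a} → a ≤ a₀ + K → a + (L * K + B) ≤ a₀ + (suc L * K + B)
layer-step-≤ a₀ K L B {a} a≤ = begin
  a + (L * K + B)         ≤⟨ +-monoˡ-≤ (L * K + B) a≤ ⟩
  a₀ + K + (L * K + B)    ≡⟨ +-assoc a₀ K (L * K + B) ⟩
  a₀ + (K + (L * K + B))  ≡⟨ cong (a₀ +_) (+-assoc K (L * K) B) ⟨
  a₀ + (suc L * K + B)    ∎
  where open ≤-Reasoning

layers-≤ : ∀ {n a K B} → 1 ≤ n → a ≤ K → B ≤ K → a + ((n ∸ 1) * K + B) ≤ 2 * n * K
layers-≤ {n} {a} {K} {B} 1≤n a≤K B≤K = begin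
  a + ((n ∸ 1) * K + B)  ≤⟨ +-mono-≤ a≤K (+-monoʳ-≤ ((n ∸ 1) * K) B≤K) ⟩
  K + ((n ∸ 1) * K + K)  ≡⟨ cong (K +_) (trans (+-comm _ K) (cong (_* K) (m+[n∸m]≡n 1≤n))) ⟩
  K + n * K              ≤⟨ +-monoˡ-≤ (n * K) (≤-trans (≤-reflexive (sym (*-identityˡ K)))
                                                      (*-monoˡ-≤ K 1≤n)) ⟩
  n * K + n * K          ≡⟨ solve 2 (λ n K → n :* K :+ n :* K := con 2 :* n :* K) refl n K ⟩
  2 * n * K              ∎
  where open ≤-Reasoning

length-range : ∀ a b → length (range a b) ≡ suc b ∸ a
length-range a b = trans (length-map (a +_) (upTo (suc b ∸ a))) (length-upTo (suc b ∸ a))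

range-≤ : ∀ a b → All (_≤ b) (range a b)
range-≤ a b = map⁺ (applyUpTo⁺₁ _ (suc b ∸ a) (λ i<b → s≤s⁻¹ (m<n∸o⇒o+m<n a i<b)))

sum-map-≤ : ∀ (f : ℕ → ℕ) {B xs} → All (λ x → f x ≤ B) xs → sum (map f xs) ≤ length xs * B
sum-map-≤ f []             = z≤n
sum-map-≤ f (fx≤B ∷ fxs≤B) = +-mono-≤ fx≤B (sum-map-≤ f fxs≤B)

sumBelow : ℕ → (ℕ → ℕ) → ℕ
sumBelow zero    f = 0
sumBelow (suc N) f = sumBelow N f + f N

sumBelow-mono : ∀ N {f g : ℕ → ℕ} → (∀ i → f i ≤ g i) → sumBelow N f ≤ sumBelow N g
sumBelow-mono zero    _   = z≤n
sumBelow-mono (suc N) f≤g = +-mono-≤ (sumBelow-mono N f≤g) (f≤g N)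

sumBelow-mono-< : ∀ N {f g : ℕ → ℕ} → (∀ i → f i ≤ g i) →
                  ∀ {i} → i < N → f i < g i → sumBelow N f < sumBelow N g
sumBelow-mono-< (suc N) f≤g {i} i<1+N fi<gi with m<1+n⇒m<n∨m≡n i<1+N
... | inj₁ i<N  = +-mono-<-≤ (sumBelow-mono-< N f≤g i<N fi<gi) (f≤g N)
... | inj₂ refl = +-mono-≤-< (sumBelow-mono N f≤g) fi<gi

sumBelow-≤ : ∀ N {f : ℕ → ℕ} {B} → (∀ i → f i ≤ B) → sumBelow N f ≤ N * B
sumBelow-≤ zero    _           = z≤n
sumBelow-≤ (suc N) {B = B} f≤B =
  ≤-trans (+-mono-≤ (sumBelow-≤ N f≤B) (f≤B N)) (≤-reflexive (+-comm (N * B) B))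

occupied : List Triple → ℕ
occupied []      = 0
occupied (_ ∷ _) = 1

occupied≤1 : ∀ ts → occupied ts ≤ 1
occupied≤1 []      = z≤n
occupied≤1 (_ ∷ _) = ≤-refl

filled : ℕ → ℕ → Table → ℕ
filled P Q T = sumBelow P λ p → sumBelow Q λ q → occupied (T p q)

filled≤ : ∀ P Q T → filled P Q T ≤ P * Q
filled≤ P Q T = sumBelow-≤ P λ p →
  ≤-trans (sumBelow-≤ Q (λ q → occupied≤1 (T p q))) (≤-reflexive (*-identityʳ Q))

==-refl : ∀ a → (a == a) ≡ true
==-refl a = trans (isYes≗does (a ≟ a)) (dec-true (a ≟ a) refl)

upd-same : ∀ T p q v → upd T p q v p q ≡ v
upd-same T p q v rewrite ==-refl p | ==-refl q = refl

occupied-upd : ∀ T p q t a b → occupied (T a b) ≤ occupied (upd T p q (t ∷ []) a b)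
occupied-upd T p q t a b with (a == p) ∧ (b == q)
... | true  = occupied≤1 (T a b)
... | false = ≤-refl

filled-upd : ∀ {P Q T p q} t → T p q ≡ [] → p < P → q < Q →
             filled P Q T < filled P Q (upd T p q (t ∷ []))
filled-upd {P} {Q} {T} {p} {q} t empty p<P q<Q =
  sumBelow-mono-< P (λ a → sumBelow-mono Q (occupied-upd T p q t a)) p<P
    (sumBelow-mono-< Q (occupied-upd T p q t p) q<Q
      (subst₂ (λ u v → occupied u < occupied v) (sym empty) (sym (upd-same T p q (t ∷ []))) ≤-refl))

insert-time : ∀ m p q t A → Acc.time (insert m p q t A) ≡ Acc.time A
insert-time full  p q t A = refl
insert-time recon p q t (acc T c s) with T p q
... | []    = refl
... | _ ∷ _ = refl

insert-stored : ∀ m p q t A → Acc.stored (insert m p q t A) ≤ suc (Acc.stored A)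
insert-stored full  p q t A = ≤-refl
insert-stored recon p q t (acc T c s) with T p q
... | []    = ≤-refl
... | _ ∷ _ = n≤1+n s

StoredWithin : ℕ → ℕ → ℕ → Acc → Set
StoredWithin s₀ P Q A = Acc.stored A ≤ s₀ + filled P Q (Acc.tbl A)

insert-within : ∀ {s₀ P Q p q} t A → p < P → q < Q →
                StoredWithin s₀ P Q A → StoredWithin s₀ P Q (insert recon p q t A)
insert-within {s₀} {P} {Q} {p} {q} t (acc T c s) p<P q<Q within with T p q in empty
... | []    = begin
  suc s                                 ≤⟨ s≤s within ⟩
  suc (s₀ + filled P Q T)               ≡⟨ +-suc s₀ _ ⟨
  s₀ + suc (filled P Q T)               ≤⟨ +-monoʳ-≤ s₀ (filled-upd t empty p<P q<Q) ⟩
  s₀ + filled P Q (upd T p q (t ∷ []))  ∎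
  where open ≤-Reasoning
... | _ ∷ _ = within

data LoopStep (m : Mode) (Pos : ℕ → ℕ → Set) (A : Acc) : Acc → Set where
  skip : LoopStep m Pos A (tick A)
  put  : ∀ {p q} t → Pos p q → LoopStep m Pos A (insert m p q t (tick A))

loopStep-time : ∀ {m Pos A B} → LoopStep m Pos A B → Acc.time B ≤ Acc.time A + 1
loopStep-time {A = A} skip          = ≤-reflexive (+-comm 1 (Acc.time A))
loopStep-time {m} {A = A} (put t _) =
  ≤-reflexive (trans (insert-time m _ _ t (tick A)) (+-comm 1 (Acc.time A)))

loopStep-stored : ∀ {m Pos A B} → LoopStep m Pos A B → Acc.stored B ≤ Acc.stored A + 1
loopStep-stored {A = A} skip          = m≤m+n (Acc.stored A) 1
loopStep-stored {m} {A = A} (put t _) =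
  ≤-trans (insert-stored m _ _ t (tick A)) (≤-reflexive (+-comm 1 (Acc.stored A)))

loopStep-within : ∀ {Pos s₀ P Q A B} → (∀ {p q} → Pos p q → p < P × q < Q) →
                  LoopStep recon Pos A B → StoredWithin s₀ P Q A → StoredWithin s₀ P Q B
loopStep-within _ skip within = within
loopStep-within {A = A} inBox (put t pos) within =
  let p<P , q<Q = inBox pos in insert-within t (tick A) p<P q<Q within

-- Defs keeps the bodies of the loops of stepFirst and stepSecond local. They are recovered as
-- the metavariables solved by the unfolding equations, which hold by refl. The local insertion
-- helper of stepSecond is parameterised by c and s, hence so is secondBody.
mutual
  firstBody : Mode → (ℕ → ℕ) → ℕ → Table → (x p q : ℕ) → Acc → Acc
  firstBody m α k P x p q A = _

  stepFirst-loops : ∀ m α k P c s → stepFirst m α k P c s ≡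
    foldl (λ A₁ x → foldl (λ A₂ p → foldl (λ A₃ q → firstBody m α k P x p q A₃)
                                           A₂ (range 0 (qmax α k)))
                          A₁ (range 0 (pmax α k)))
          (acc emptyTable (c + cells α (suc k)) s) (range 1 (pmax α (suc k)))
  stepFirst-loops m α k P c s = refl

mutual
  secondBody : Mode → (ℕ → ℕ) → ℕ → Table → (c s p q : ℕ) → Acc → Acc
  secondBody m α n P c s p q A = _

  stepSecond-loops : ∀ m α n P c s → stepSecond m α n P c s ≡
    foldl (λ A₁ p → foldl (λ A₂ q → secondBody m α n P c s p q A₂) A₁ (range 0 (qmax α (n ∸ 1))))
          (acc emptyTable (c + cells α n) s) (range 0 (pmax α (n ∸ 1)))
  stepSecond-loops m α n P c s = refl

firstBody-step : ∀ m α k P x p q A →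
  LoopStep m (λ p′ q′ → p′ ≡ p + x × q′ ≡ q + x * ext α (suc k)) A (firstBody m α k P x p q A)
firstBody-step m α k P x p q A = if-elim (LoopStep m _ A) (put _ (refl , refl)) skip

secondBody-step : ∀ m α n P c s p q A → LoopStep m (λ _ _ → ⊤) A (secondBody m α n P c s p q A)
secondBody-step m α n P c s p q A with intB p q (ext α n)
... | nothing = if-elim (LoopStep m _ A) skip skip
... | just t  = if-elim (LoopStep m _ A) (put _ tt) skip

firstLayer : Mode → (ℕ → ℕ) → ℕ → Acc → Acc
firstLayer m α k A = stepFirst m α k (Acc.tbl A) (Acc.time A) (Acc.stored A)

lastLayer : Mode → (ℕ → ℕ) → ℕ → Acc → Acc
lastLayer m α n A = stepSecond m α n (Acc.tbl A) (Acc.time A) (Acc.stored A)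

grid-size : ∀ a b → length (range 0 a) * (length (range 0 b) * 1) ≡ suc a * suc b
grid-size a b = cong₂ _*_ (length-range 0 a) (trans (*-identityʳ _) (length-range 0 b))

sweep-size : ∀ α k → length (range 1 (pmax α (suc k))) *
                     (length (range 0 (pmax α k)) * (length (range 0 (qmax α k)) * 1))
                   ≡ pmax α (suc k) * cells α k
sweep-size α k = cong₂ _*_ (length-range 1 (pmax α (suc k))) (grid-size (pmax α k) (qmax α k))

module _ (m : Mode) (α : ℕ → ℕ) where

  firstLayer-≤ : ∀ (μ : Acc → ℕ) {k} A →
                 (∀ P x p q B → μ (firstBody m α k P x p q B) ≤ μ B + 1) →
                 μ (firstLayer m α k A) ≤
                 μ (acc emptyTable (Acc.time A + cells α (suc k)) (Acc.stored A))
                   + pmax α (suc k) * cells α k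
  firstLayer-≤ μ {k} A body-≤ = begin
    μ (firstLayer m α k A)
      ≡⟨ cong μ (stepFirst-loops m α k (Acc.tbl A) (Acc.time A) (Acc.stored A)) ⟩
    μ (foldl _ A₀ xs)
      ≤⟨ foldl-≤ μ (λ A₁ x → foldl-≤ μ (λ A₂ p → foldl-≤ μ (λ A₃ q → body-≤ (Acc.tbl A) x p q A₃)
                                                             A₂ qs) A₁ ps) A₀ xs ⟩
    μ A₀ + length xs * (length ps * (length qs * 1))
      ≡⟨ cong (μ A₀ +_) (sweep-size α k) ⟩
    μ A₀ + pmax α (suc k) * cells α k
      ∎
    where
    open ≤-Reasoning
    A₀ : Acc
    A₀ = acc emptyTable (Acc.time A + cells α (suc k)) (Acc.stored A)
    xs ps qs : List ℕ
    xs = range 1 (pmax α (suc k))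
    ps = range 0 (pmax α k)
    qs = range 0 (qmax α k)

  firstLayer-time : ∀ k A → Acc.time (firstLayer m α k A) ≤
                            Acc.time A + (cells α (suc k) + pmax α (suc k) * cells α k)
  firstLayer-time k A =
    ≤-trans (firstLayer-≤ Acc.time A (λ P x p q B → loopStep-time (firstBody-step m α k P x p q B)))
            (≤-reflexive (+-assoc (Acc.time A) _ _))

  firstLayer-stored : ∀ k A → Acc.stored (firstLayer m α k A) ≤
                              Acc.stored A + pmax α (suc k) * cells α k
  firstLayer-stored k A =
    firstLayer-≤ Acc.stored A (λ P x p q B → loopStep-stored (firstBody-step m α k P x p q B))

  lastLayer-≤ : ∀ (μ : Acc → ℕ) {n} A →
                (∀ P c s p q B → μ (secondBody m α n P c s p q B) ≤ μ B + 1) →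
                μ (lastLayer m α n A) ≤
                μ (acc emptyTable (Acc.time A + cells α n) (Acc.stored A)) + cells α (n ∸ 1)
  lastLayer-≤ μ {n} A body-≤ = begin
    μ (lastLayer m α n A)
      ≡⟨ cong μ (stepSecond-loops m α n T c s) ⟩
    μ (foldl _ A₀ ps)
      ≤⟨ foldl-≤ μ (λ A₁ p → foldl-≤ μ (λ A₂ q → body-≤ T c s p q A₂) A₁ qs) A₀ ps ⟩
    μ A₀ + length ps * (length qs * 1)
      ≡⟨ cong (μ A₀ +_) (grid-size (pmax α (n ∸ 1)) (qmax α (n ∸ 1))) ⟩
    μ A₀ + cells α (n ∸ 1)
      ∎
    where
    open ≤-Reasoning
    T : Table
    T = Acc.tbl A
    c s : ℕ
    c = Acc.time A
    s = Acc.stored A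
    A₀ : Acc
    A₀ = acc emptyTable (c + cells α n) s
    ps qs : List ℕ
    ps = range 0 (pmax α (n ∸ 1))
    qs = range 0 (qmax α (n ∸ 1))

  lastLayer-time : ∀ n A → Acc.time (lastLayer m α n A) ≤ Acc.time A + (cells α n + cells α (n ∸ 1))
  lastLayer-time n A =
    ≤-trans (lastLayer-≤ Acc.time A (λ P c s p q B → loopStep-time (secondBody-step m α n P c s p q B)))
            (≤-reflexive (+-assoc (Acc.time A) _ _))

  lastLayer-stored : ∀ n A → Acc.stored (lastLayer m α n A) ≤ Acc.stored A + cells α (n ∸ 1)
  lastLayer-stored n A =
    lastLayer-≤ Acc.stored A (λ P c s p q B → loopStep-stored (secondBody-step m α n P c s p q B))

firstLayer-stored-recon : ∀ α k A → Acc.stored (firstLayer recon α k A) ≤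
  Acc.stored A + suc (pmax α k + pmax α (suc k)) * suc (qmax α k + qmax α (suc k))
firstLayer-stored-recon α k A = begin
  Acc.stored (firstLayer recon α k A)                   ≤⟨ within ⟩
  s + filled Pb Qb (Acc.tbl (firstLayer recon α k A))  ≤⟨ +-monoʳ-≤ s (filled≤ Pb Qb _) ⟩
  s + Pb * Qb                                           ∎
  where
  open ≤-Reasoning
  T : Table
  T = Acc.tbl A
  a s Pb Qb : ℕ
  a = ext α (suc k)
  s = Acc.stored A
  Pb = suc (pmax α k + pmax α (suc k))
  Qb = suc (qmax α k + qmax α (suc k))
  I : Acc → Set
  I = StoredWithin s Pb Qb
  inBox : ∀ {x p q} → x ≤ pmax α (suc k) → p ≤ pmax α k → q ≤ qmax α k →
          ∀ {p′ q′} → p′ ≡ p + x × q′ ≡ q + x * a → p′ < Pb × q′ < Qb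
  inBox x≤ p≤ q≤ (refl , refl) = s≤s (+-mono-≤ p≤ x≤) , s≤s (+-mono-≤ q≤ (*-monoˡ-≤ a x≤))
  within : I (firstLayer recon α k A)
  within = subst I (sym (stepFirst-loops recon α k T (Acc.time A) s))
    (foldl-preserves I (λ x x≤ →
      foldl-preserves I (λ p p≤ →
        foldl-preserves I (λ q q≤ →
          loopStep-within {s₀ = s} {Pb} {Qb} (inBox x≤ p≤ q≤) (firstBody-step recon α k T x p q _))
          (range-≤ 0 (qmax α k)))
        (range-≤ 0 (pmax α k)))
      (range-≤ 1 (pmax α (suc k))) (m≤m+n s _))

resume-≤ : (layer : ℕ → Acc → Acc) (μ : Acc → ℕ) {G : ℕ → Set} {K B : ℕ}
           (Q : List ℕ → List Table → Acc → ℕ) →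
           (∀ k A → G k → μ (layer k A) ≤ μ A + K) →
           (∀ d A → Q [] d A ≤ μ A + B) →
           (∀ k ks d A → Q (k ∷ ks) d A ≡ Q ks (Acc.tbl A ∷ d) (layer k A)) →
           ∀ {ks} → All G ks → ∀ d A → Q ks d A ≤ μ A + (length ks * K + B)
resume-≤ _ _ _ _ last-≤ _ [] d A = last-≤ d A
resume-≤ layer μ {K = K} {B} Q layer-≤ last-≤ resume {k ∷ ks} (Gk ∷ Gks) d A =
  ≤-trans (≤-reflexive (resume k ks d A))
    (≤-trans (resume-≤ layer μ Q layer-≤ last-≤ resume Gks _ _)
             (layer-step-≤ (μ A) K (length ks) B (layer-≤ k A Gk)))

observe : (ℕ → ℕ → ℕ) → Acc → ℕ
observe π A = π (Acc.time A) (Acc.stored A)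

net-≤ : ∀ m α n (π : ℕ → ℕ → ℕ) {K B} →
        (∀ k A → k < n ∸ 1 → observe π (firstLayer m α k A) ≤ observe π A + K) →
        (∀ A → observe π (lastLayer m α n A) ≤ observe π A + B) →
        π (Run.time (net m α n)) (Run.stored (net m α n)) ≤ π (cells α 0) 1 + ((n ∸ 1) * K + B)
net-≤ m α n π {K} {B} first-≤ last-≤ =
  subst (λ ℓ → π (Run.time (net m α n)) (Run.stored (net m α n)) ≤ π (cells α 0) 1 + (ℓ * K + B))
        (length-upTo (n ∸ 1)) resumed
  where
  -- The state type of net is private to Defs. Q, the observation of the run resumed with the
  -- layers ks from the finished tables d and the accumulator A, is solved from the goal below
  -- once the first layer is peeled off so that ks, d and A are variables; it has to be
  -- declared outside the with-clauses, whose context already contains them.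
  Q : List ℕ → List Table → Acc → ℕ
  Q ks d A = _

  resumed : π (Run.time (net m α n)) (Run.stored (net m α n)) ≤
            π (cells α 0) 1 + (length (upTo (n ∸ 1)) * K + B)
  resumed with upTo (n ∸ 1) | all-upTo (n ∸ 1) | L₀
  ... | []     | []       | T₀ = last-≤ (acc T₀ (cells α 0) 1)
  ... | k ∷ ks | k< ∷ ks< | T₀
    with stepFirst m α k T₀ (cells α 0) 1 | first-≤ k (acc T₀ (cells α 0) 1) k<
  -- with-abstraction finds this list in the normalised goal only if Table is written unfolded.
  ... | A | A≤ with Data.List._∷_ {A = ℕ → ℕ → List Triple} T₀ []
  ... | d = ≤-trans (resume-≤ (firstLayer m α) (observe π) Q first-≤ (λ _ A → last-≤ A)
                              (λ _ _ _ _ → refl) ks< d A)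
                    (layer-step-≤ (π (cells α 0) 1) K (length ks) B A≤)

module _ {α : ℕ → ℕ} {n : ℕ} (inc : StrictlyIncreasing α n) where

  increasing-≤ : ∀ {i j} → 1 ≤ i → i ≤′ j → j ≤ n → α i ≤ α j
  increasing-≤ _   (≤′-reflexive refl) _     = ≤-refl
  increasing-≤ 1≤i (≤′-step {j} i≤′j) 1+j≤n =
    ≤-trans (increasing-≤ 1≤i i≤′j (<⇒≤ 1+j≤n)) (<⇒≤ (inc j (≤-trans 1≤i (≤′⇒≤ i≤′j)) 1+j≤n))

  ext≤top : ∀ {j} → j ≤ n → ext α j ≤ α n
  ext≤top {zero}  _   = z≤n
  ext≤top {suc j} j≤n = increasing-≤ (s≤s z≤n) (≤⇒≤′ j≤n) ≤-refl

  top-positive : 2 ≤ n → 1 ≤ α n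
  top-positive 2≤n =
    ≤-trans (≤-trans (s≤s z≤n) (inc 1 ≤-refl 2≤n)) (increasing-≤ (s≤s z≤n) (≤⇒≤′ 2≤n) ≤-refl)

module Sizes (α : ℕ → ℕ) {M : ℕ} (1≤M : 1 ≤ M) where

  X : ℕ
  X = 4 * M

  1≤X : 1 ≤ X
  1≤X = ≤-trans 1≤M (m≤n*m M 4)

  X³≤X⁴ : X ^ 3 ≤ X ^ 4
  X³≤X⁴ = ≤-trans (≤-reflexive (sym (*-identityˡ (X ^ 3)))) (*-monoˡ-≤ (X ^ 3) 1≤X)

  pmax<X : ∀ j → ext α j ≤ M → pmax α j < X
  pmax<X j e≤M = begin
    suc (2 * e + 1)  ≡⟨ solve 1 (λ e → con 1 :+ (con 2 :* e :+ con 1) := con 2 :* (con 1 :+ e)) refl e ⟩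
    2 * (1 + e)      ≤⟨ *-monoʳ-≤ 2 (+-mono-≤ 1≤M e≤M) ⟩
    2 * (M + M)      ≡⟨ solve 1 (λ M → con 2 :* (M :+ M) := con 4 :* M) refl M ⟩
    X                ∎
    where
    open ≤-Reasoning
    e : ℕ
    e = ext α j

  qmax<X² : ∀ j → ext α j ≤ M → qmax α j < X ^ 2
  qmax<X² j e≤M = begin
    suc (pmax α j * e)      ≤⟨ suc-*-≤ (pmax α j) e ⟩
    suc (pmax α j) * suc e  ≤⟨ *-mono-≤ (pmax<X j e≤M) (≤-trans (s≤s e≤pmax) (pmax<X j e≤M)) ⟩
    X * X                   ≡⟨ cong (X *_) (*-identityʳ X) ⟨
    X ^ 2                   ∎
    where
    open ≤-Reasoning
    e : ℕ
    e = ext α j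
    e≤pmax : e ≤ pmax α j
    e≤pmax = ≤-trans (m≤m+n e (e + 0)) (m≤m+n (2 * e) 1)

  cells≤X³ : ∀ j → ext α j ≤ M → cells α j ≤ X ^ 3
  cells≤X³ j e≤M = *-mono-≤ (pmax<X j e≤M) (qmax<X² j e≤M)

  sweep≤X⁴ : ∀ k → ext α k ≤ M → ext α (suc k) ≤ M → pmax α (suc k) * cells α k ≤ X ^ 4
  sweep≤X⁴ k e≤M e′≤M = *-mono-≤ (<⇒≤ (pmax<X (suc k) e′≤M)) (cells≤X³ k e≤M)

  box≤4X³ : ∀ k → ext α k ≤ M → ext α (suc k) ≤ M →
            suc (pmax α k + pmax α (suc k)) * suc (qmax α k + qmax α (suc k)) ≤ 4 * X ^ 3
  box≤4X³ k e≤M e′≤M = begin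
    suc (pmax α k + pmax α (suc k)) * suc (qmax α k + qmax α (suc k))
      ≤⟨ *-mono-≤ (suc-+-≤ (pmax α k) _) (suc-+-≤ (qmax α k) _) ⟩
    (suc (pmax α k) + suc (pmax α (suc k))) * (suc (qmax α k) + suc (qmax α (suc k)))
      ≤⟨ *-mono-≤ (+-mono-≤ (pmax<X k e≤M) (pmax<X (suc k) e′≤M))
                  (+-mono-≤ (qmax<X² k e≤M) (qmax<X² (suc k) e′≤M)) ⟩
    (X + X) * (X ^ 2 + X ^ 2)
      ≡⟨ solve 1 (λ X → (X :+ X) :* (X :^ 2 :+ X :^ 2) := con 4 :* X :^ 3) refl X ⟩
    4 * X ^ 3
      ∎
    where open ≤-Reasoning

module Bounds {α : ℕ → ℕ} {n : ℕ} (2≤n : 2 ≤ n) (inc : StrictlyIncreasing α n) where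
  open Sizes α (top-positive inc 2≤n)

  1≤n : 1 ≤ n
  1≤n = ≤-trans (n≤1+n 1) 2≤n

  1+n≤2n : suc n ≤ 2 * n
  1+n≤2n = ≤-trans (+-monoˡ-≤ n 1≤n) (≤-reflexive (cong (n +_) (sym (+-identityʳ n))))

  below : ∀ j → j ≤ n → ext α j ≤ α n
  below j = ext≤top inc

  layer-below : ∀ {k} → k < n ∸ 1 → k ≤ n × suc k ≤ n
  layer-below k< = let 1+k≤n = ≤-trans k< (m∸n≤m _ 1) in <⇒≤ 1+k≤n , 1+k≤n

  cells≤ : ∀ {j} → j ≤ n → cells α j ≤ X ^ 3
  cells≤ {j} j≤n = cells≤X³ j (below j j≤n)

  all-cells-≤ : ∀ {Y} → X ^ 3 ≤ Y → sum (map (cells α) (range 0 n)) ≤ suc n * Y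
  all-cells-≤ {Y} X³≤Y =
    ≤-trans (sum-map-≤ (cells α) (All.map (λ j≤n → ≤-trans (cells≤ j≤n) X³≤Y) (range-≤ 0 n)))
            (≤-reflexive (cong (_* Y) (length-range 0 n)))

  time-≤ : ∀ m → timeOf (net m α n) ≤ 2 * n * (X ^ 4 + X ^ 4)
  time-≤ m = ≤-trans (net-≤ m α n (λ c s → c) first last) (layers-≤ 1≤n init ≤-refl)
    where
    X⁴ : ℕ
    X⁴ = X ^ 4
    up : ∀ {j} → j ≤ n → cells α j ≤ X⁴
    up j≤n = ≤-trans (cells≤ j≤n) X³≤X⁴
    init : cells α 0 ≤ X⁴ + X⁴
    init = ≤-trans (up z≤n) (m≤m+n X⁴ X⁴)
    first : ∀ k A → k < n ∸ 1 → Acc.time (firstLayer m α k A) ≤ Acc.time A + (X⁴ + X⁴)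
    first k A k< = let k≤n , 1+k≤n = layer-below k< in
      ≤-trans (firstLayer-time m α k A)
        (+-monoʳ-≤ _ (+-mono-≤ (up 1+k≤n) (sweep≤X⁴ k (below k k≤n) (below (suc k) 1+k≤n))))
    last : ∀ A → Acc.time (lastLayer m α n A) ≤ Acc.time A + (X⁴ + X⁴)
    last A = ≤-trans (lastLayer-time m α n A) (+-monoʳ-≤ _ (+-mono-≤ (up ≤-refl) (up (m∸n≤m n 1))))

  stored-≤ : ∀ m {K} → (∀ k A → k < n ∸ 1 → Acc.stored (firstLayer m α k A) ≤ Acc.stored A + K) →
             cells α (n ∸ 1) ≤ K → Run.stored (net m α n) ≤ 2 * n * K
  stored-≤ m {K} first last≤K =
    ≤-trans (net-≤ m α n (λ c s → s) first last) (layers-≤ 1≤n (≤-trans (s≤s z≤n) last≤K) ≤-refl)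
    where
    last : ∀ A → Acc.stored (lastLayer m α n A) ≤ Acc.stored A + K
    last A = ≤-trans (lastLayer-stored m α n A) (+-monoʳ-≤ _ last≤K)

  time-bound : ∀ m → timeOf (net m α n) ≤ 1024 * n * α n ^ 4
  time-bound m = ≤-trans (time-≤ m)
    (≤-reflexive (solve 2 (λ n M → con 2 :* n :* ((con 4 :* M) :^ 4 :+ (con 4 :* M) :^ 4)
                                   := con 1024 :* n :* M :^ 4) refl n (α n)))

  space-bound-full : spaceOf α n (net full α n) ≤ 1024 * n * α n ^ 4
  space-bound-full = begin
    spaceOf α n (net full α n)
      ≤⟨ +-mono-≤ (all-cells-≤ X³≤X⁴) (stored-≤ full first (≤-trans (cells≤ (m∸n≤m n 1)) X³≤X⁴)) ⟩
    suc n * X ^ 4 + 2 * n * X ^ 4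
      ≤⟨ +-monoˡ-≤ _ (*-monoˡ-≤ (X ^ 4) 1+n≤2n) ⟩
    2 * n * X ^ 4 + 2 * n * X ^ 4
      ≡⟨ solve 2 (λ n M → con 2 :* n :* (con 4 :* M) :^ 4 :+ con 2 :* n :* (con 4 :* M) :^ 4
                          := con 1024 :* n :* M :^ 4) refl n (α n) ⟩
    1024 * n * α n ^ 4
      ∎
    where
    open ≤-Reasoning
    first : ∀ k A → k < n ∸ 1 → Acc.stored (firstLayer full α k A) ≤ Acc.stored A + X ^ 4
    first k A k< = let k≤n , 1+k≤n = layer-below k< in
      ≤-trans (firstLayer-stored full α k A)
              (+-monoʳ-≤ _ (sweep≤X⁴ k (below k k≤n) (below (suc k) 1+k≤n)))

  space-bound-recon : spaceOf α n (net recon α n) ≤ 640 * n * α n ^ 3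
  space-bound-recon = begin
    spaceOf α n (net recon α n)
      ≤⟨ +-mono-≤ (all-cells-≤ ≤-refl)
                  (stored-≤ recon first (≤-trans (cells≤ (m∸n≤m n 1)) (m≤n*m (X ^ 3) 4))) ⟩
    suc n * X ^ 3 + 2 * n * (4 * X ^ 3)
      ≤⟨ +-monoˡ-≤ _ (*-monoˡ-≤ (X ^ 3) 1+n≤2n) ⟩
    2 * n * X ^ 3 + 2 * n * (4 * X ^ 3)
      ≡⟨ solve 2 (λ n M → con 2 :* n :* (con 4 :* M) :^ 3 :+ con 2 :* n :* (con 4 :* (con 4 :* M) :^ 3)
                          := con 640 :* n :* M :^ 3) refl n (α n) ⟩
    640 * n * α n ^ 3
      ∎
    where
    open ≤-Reasoning
    first : ∀ k A → k < n ∸ 1 → Acc.stored (firstLayer recon α k A) ≤ Acc.stored A + 4 * X ^ 3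
    first k A k< = let k≤n , 1+k≤n = layer-below k< in
      ≤-trans (firstLayer-stored-recon α k A)
              (+-monoʳ-≤ _ (box≤4X³ k (below k k≤n) (below (suc k) 1+k≤n)))

theorem3p2 : (∃ λ C → ∀ (n : ℕ) (α : ℕ → ℕ) → 2 ≤ n → StrictlyIncreasing α n →
                 (timeOf (net full α n) ≤ C * n * α n ^ 4)
                 × (spaceOf α n (net full α n) ≤ C * n * α n ^ 4))
             × (∃ λ C → ∀ (n : ℕ) (α : ℕ → ℕ) → 2 ≤ n → StrictlyIncreasing α n →
                 spaceOf α n (net recon α n) ≤ C * n * α n ^ 3)
theorem3p2 =
  (1024 , λ n α 2≤n inc → let open Bounds 2≤n inc in time-bound full , space-bound-full) ,
  (640  , λ n α 2≤n inc → Bounds.space-bound-recon 2≤n inc)
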